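{- Let $H$ be a nontrivial, connected graph and let $G$ be a graph with no isolatable vertices such that $G \times H$ is well-covered. If $k\in \{1,\dots,\alpha(G)\}$ and $A$ is any independent set of $G$ with $|A|=k$, then $|N[A]|=k\,\frac{n(G)}{\alpha(G)}$.
   Context: Graphs are finite and simple; nontrivial means having at least two vertices. The direct product $G\times H$ has vertex set $V(G)\times V(H)$, with $(g_1,h_1)(g_2,h_2)$ an edge iff $g_1g_2\in E(G)$ and $h_1h_2\in E(H)$. A graph is well-covered if all of its maximal independent sets have the same cardinality. A vertex $x$ of $G$ is isolatable if there exists an independent set $I$ of $G$ such that $x$ is an isolated vertex of $G-N[I]$ ($I$ may be empty). $N[A]$ is the closed neighborhood of $A$, $\alpha(G)$ the independence number and $n(G)$ the order of $G$. -}

module Defs where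

open import Data.Nat using (ℕ; _≤_; _*_)
open import Data.Fin using (Fin; remQuot)
open import Data.Bool using (Bool; true; false; _∧_; _∨_)
open import Data.Vec using (lookup; tabulate)
open import Data.List using (allFin)
open import Data.Bool.ListAction using (any)
open import Data.Fin.Subset using (Subset; _∈_; _∉_; _⊆_; ∣_∣)
open import Data.Product using (Σ; ∃; _×_; _,_; proj₁; proj₂)
open import Relation.Binary.PropositionalEquality using (_≡_; refl; cong₂)
open import Relation.Nullary using (¬_)

record Graph : Set where
  field
    n      : ℕ
    adj    : Fin n → Fin n → Bool
    sym    : ∀ x y → adj x y ≡ adj y x
    irrefl : ∀ x → adj x x ≡ false
open Graph public

order : Graph → ℕ
order G = n G

Adj : (G : Graph) → Fin (n G) → Fin (n G) → Set
Adj G x y = adj G x y ≡ true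

Nontrivial : Graph → Set
Nontrivial G = 2 ≤ n G

data Walk (G : Graph) : Fin (n G) → Fin (n G) → Set where
  here : ∀ {x} → Walk G x x
  step : ∀ {x y z} → Adj G x y → Walk G y z → Walk G x z

Connected : Graph → Set
Connected G = ∀ x y → Walk G x y

Independent : (G : Graph) → Subset (n G) → Set
Independent G I = ∀ x y → x ∈ I → y ∈ I → ¬ Adj G x y

MaximalIndependent : (G : Graph) → Subset (n G) → Set
MaximalIndependent G I =
  Independent G I × (∀ J → Independent G J → I ⊆ J → J ≡ I)

WellCovered : Graph → Set
WellCovered G = ∀ I J → MaximalIndependent G I → MaximalIndependent G J → ∣ I ∣ ≡ ∣ J ∣

IsIndependenceNumber : Graph → ℕ → Set
IsIndependenceNumber G a =
  (Σ (Subset (n G)) λ I → Independent G I × ∣ I ∣ ≡ a)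
  × (∀ I → Independent G I → ∣ I ∣ ≤ a)

N[_] : {G : Graph} → Subset (n G) → Subset (n G)
N[_] {G} A = tabulate λ x → lookup A x ∨ any (λ y → lookup A y ∧ adj G x y) (allFin (n G))

-- x is isolatable: some independent I makes x an isolated vertex of G - N[I]
Isolatable : (G : Graph) → Fin (n G) → Set
Isolatable G x = Σ (Subset (n G)) λ I →
  Independent G I × (x ∉ N[_] {G} I) × (∀ y → Adj G x y → y ∈ N[_] {G} I)

NoIsolatable : Graph → Set
NoIsolatable G = ∀ x → ¬ Isolatable G x

-- direct (tensor) product, vertex set Fin (n G * n H) ≅ Fin (n G) × Fin (n H) via remQuot
private
  ∧-comm : ∀ a b → (a ∧ b) ≡ (b ∧ a)
  ∧-comm false false = refl
  ∧-comm false true = refl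
  ∧-comm true false = refl
  ∧-comm true true = refl

_×ᴳ_ : Graph → Graph → Graph
G ×ᴳ H = record
  { n = n G * n H
  ; adj = λ u v → let (g₁ , h₁) = remQuot {n G} (n H) u
                      (g₂ , h₂) = remQuot {n G} (n H) v
                  in adj G g₁ g₂ ∧ adj H h₁ h₂
  ; sym = λ u v → cong₂ _∧_ (sym G _ _) (sym H _ _)
  ; irrefl = λ u → irr (adj G _ _) (irrefl G (proj₁ (remQuot {n G} (n H) u)))
  }
  where
  irr : ∀ a {b} → a ≡ false → (a ∧ b) ≡ false
  irr .false refl = refl

-- Fix an independent dominating set B of H (greedy extension yields one). For an
-- independent set A of G, the set  A × V(H) ∪ (V(G) ∖ N[A]) × B  is a maximal independent
-- set of G × H: two of its vertices can only be adjacent inside (V(G) ∖ N[A]) × B, where B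
-- is independent; a vertex (g , h) outside it has a neighbour in it, through a neighbour of
-- g in A when g ∈ N[A] (H has no isolated vertex), and otherwise through a neighbour of g
-- outside N[A] (g is not isolatable) together with a neighbour of h in B. Well-coveredness
-- makes its size  |A| n(H) + (n(G) − |N[A]|) |B|  independent of A. It is n(G) |B| for
-- A = ∅ and α n(H) for a maximum independent set A (whose closed neighbourhood is V(G)),
-- so |A| n(H) = |N[A]| |B| and α n(H) = n(G) |B|; eliminating n(H) / |B| gives the claim.

module Submission where

open import Defs hiding (sym)
open import Data.Bool as Bool using (true; T; _∧_; _∨_)
open import Data.Bool.ListAction using (any)
open import Data.Bool.Properties using (T-≡; T-∧; T-∨)
open import Data.Fin using (Fin; zero; suc; combine; remQuot; punchIn; fromℕ<)
open import Data.Fin.Properties using (punchInᵢ≢i; remQuot-combine; combine-remQuot; any?; ¬∀⟶∃¬)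
open import Data.Fin.Subset using (Subset; inside; outside; _∈_; _∉_; _⊆_; ∣_∣; _∪_; _∩_; ∁; ⁅_⁆; ⊤; ⊥; Empty; Nonempty)
open import Data.Fin.Subset.Properties
  using ( _∈?_; ∈⊤; ∉⊥; x∈⁅y⁆⇒x≡y; x∈p∪q⁺; x∈p∪q⁻; x∈p∩q⁻; x∈p⇒x∉∁p; x∈∁p⇒x∉p; x∉p⇒x∈∁p
        ; ⊆-antisym; drop-∷-Empty; Empty-unique
        ; ∣⊥∣≡0; ∣⊤∣≡n; ∣⁅x⁆∣≡1; ∣∁p∣≡n∸∣p∣; ∣p∣≤n; x∈p⇒∣p-x∣<∣p∣)
open import Data.List using (allFin)
open import Data.List.Membership.Propositional using (lose)
open import Data.List.Membership.Propositional.Properties using (∈-allFin)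
open import Data.List.Relation.Unary.Any using (satisfied)
open import Data.List.Relation.Unary.Any.Properties using (any⁺; any⁻)
open import Data.Nat using (ℕ; zero; suc; _+_; _*_; _∸_; _≤_; _<_; z≤n; s≤s; NonZero; >-nonZero)
open import Data.Nat.Properties
  using ( ≤-refl; ≤-reflexive; ≤-<-trans; <⇒≱; ≤⇒≯; +-comm; +-suc; +-identityʳ; +-cancelʳ-≡; m+[n∸m]≡n
        ; *-comm; *-assoc; *-distribʳ-+; *-cancelʳ-≡)
open import Data.Product using (∃; _×_; _,_; proj₁; proj₂; uncurry)
open import Data.Sum using (_⊎_; inj₁; inj₂; [_,_]′)
open import Data.Vec using ([]; _∷_; _++_; map; lookup; _⊛*_; here)
open import Data.Vec.Properties using (lookup-⊛*; lookup-map; lookup∘tabulate; map-id; map-const; []=⇒lookup; lookup⇒[]=)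
open import Function using (_∘_; id; const; _⇔_; Equivalence; mk⇔)
open import Relation.Binary.PropositionalEquality using (_≡_; _≢_; refl; sym; trans; cong; cong₂; subst; module ≡-Reasoning)
open import Relation.Nullary using (¬_; yes; no; contradiction)
open import Relation.Nullary.Decidable using (decidable-stable; ¬?; _→-dec_)

open Equivalence using (to; from)

∣p++q∣≡∣p∣+∣q∣ : ∀ {m k} (p : Subset m) (q : Subset k) → ∣ p ++ q ∣ ≡ ∣ p ∣ + ∣ q ∣
∣p++q∣≡∣p∣+∣q∣ []            q = refl
∣p++q∣≡∣p∣+∣q∣ (inside  ∷ p) q = cong suc (∣p++q∣≡∣p∣+∣q∣ p q)
∣p++q∣≡∣p∣+∣q∣ (outside ∷ p) q = ∣p++q∣≡∣p∣+∣q∣ p q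

∣p∪q∣≡∣p∣+∣q∣ : ∀ {m} (p q : Subset m) → Empty (p ∩ q) → ∣ p ∪ q ∣ ≡ ∣ p ∣ + ∣ q ∣
∣p∪q∣≡∣p∣+∣q∣ []            []            _ = refl
∣p∪q∣≡∣p∣+∣q∣ (inside  ∷ p) (inside  ∷ q) e = contradiction (zero , here) e
∣p∪q∣≡∣p∣+∣q∣ (inside  ∷ p) (outside ∷ q) e = cong suc (∣p∪q∣≡∣p∣+∣q∣ p q (drop-∷-Empty e))
∣p∪q∣≡∣p∣+∣q∣ (outside ∷ p) (inside  ∷ q) e =
  trans (cong suc (∣p∪q∣≡∣p∣+∣q∣ p q (drop-∷-Empty e))) (sym (+-suc ∣ p ∣ ∣ q ∣))
∣p∪q∣≡∣p∣+∣q∣ (outside ∷ p) (outside ∷ q) e = ∣p∪q∣≡∣p∣+∣q∣ p q (drop-∷-Empty e)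

∣p∣+∣∁p∣≡n : ∀ {m} (p : Subset m) → ∣ p ∣ + ∣ ∁ p ∣ ≡ m
∣p∣+∣∁p∣≡n p = trans (cong (∣ p ∣ +_) (∣∁p∣≡n∸∣p∣ p)) (m+[n∸m]≡n (∣p∣≤n p))

∣p∪⁅x⁆∣≡1+∣p∣ : ∀ {m} {p : Subset m} {x} → x ∉ p → ∣ p ∪ ⁅ x ⁆ ∣ ≡ suc ∣ p ∣
∣p∪⁅x⁆∣≡1+∣p∣ {p = p} {x} x∉p = begin
  ∣ p ∪ ⁅ x ⁆ ∣      ≡⟨ ∣p∪q∣≡∣p∣+∣q∣ p ⁅ x ⁆ disjoint ⟩
  ∣ p ∣ + ∣ ⁅ x ⁆ ∣  ≡⟨ cong (∣ p ∣ +_) (∣⁅x⁆∣≡1 x) ⟩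
  ∣ p ∣ + 1          ≡⟨ +-comm ∣ p ∣ 1 ⟩
  suc ∣ p ∣          ∎
  where
  open ≡-Reasoning
  disjoint : Empty (p ∩ ⁅ x ⁆)
  disjoint (y , y∈p∩x) with x∈p∩q⁻ p ⁅ x ⁆ y∈p∩x
  ... | y∈p , y∈⁅x⁆ = x∉p (subst (_∈ p) (x∈⁅y⁆⇒x≡y x y∈⁅x⁆) y∈p)

x∈p⇒0<∣p∣ : ∀ {m} {p : Subset m} {x} → x ∈ p → 0 < ∣ p ∣
x∈p⇒0<∣p∣ x∈p = ≤-<-trans z≤n (x∈p⇒∣p-x∣<∣p∣ x∈p)

∈⇔T-lookup : ∀ {m} {p : Subset m} {x} → x ∈ p ⇔ T (lookup p x)
∈⇔T-lookup {p = p} {x} = mk⇔ (from T-≡ ∘ []=⇒lookup) (lookup⇒[]= x p ∘ to T-≡)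

infixr 8 _⊠_

_⊠_ : ∀ {m k} → Subset m → Subset k → Subset (m * k)
p ⊠ q = map _∧_ p ⊛* q

lookup-⊠ : ∀ {m k} (p : Subset m) (q : Subset k) g h →
           lookup (p ⊠ q) (combine g h) ≡ lookup p g ∧ lookup q h
lookup-⊠ p q g h = trans (lookup-⊛* (map _∧_ p) q g h) (cong (λ f → f (lookup q h)) (lookup-map g _∧_ p))

module _ {m k} {p : Subset m} {q : Subset k} {g : Fin m} {h : Fin k} where

  x∈p⊠q⁺ : g ∈ p → h ∈ q → combine g h ∈ p ⊠ q
  x∈p⊠q⁺ g∈p h∈q = from ∈⇔T-lookup
    (subst T (sym (lookup-⊠ p q g h)) (from T-∧ (to ∈⇔T-lookup g∈p , to ∈⇔T-lookup h∈q)))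

  x∈p⊠q⁻ : combine g h ∈ p ⊠ q → g ∈ p × h ∈ q
  x∈p⊠q⁻ gh∈p⊠q with to T-∧ (subst T (lookup-⊠ p q g h) (to ∈⇔T-lookup gh∈p⊠q))
  ... | tp , tq = from ∈⇔T-lookup tp , from ∈⇔T-lookup tq

∣p⊠q∣≡∣p∣*∣q∣ : ∀ {m k} (p : Subset m) (q : Subset k) → ∣ p ⊠ q ∣ ≡ ∣ p ∣ * ∣ q ∣
∣p⊠q∣≡∣p∣*∣q∣ []            q = refl
∣p⊠q∣≡∣p∣*∣q∣ (inside  ∷ p) q = begin
  ∣ map id q ++ p ⊠ q ∣     ≡⟨ ∣p++q∣≡∣p∣+∣q∣ (map id q) (p ⊠ q) ⟩
  ∣ map id q ∣ + ∣ p ⊠ q ∣  ≡⟨ cong₂ _+_ (cong ∣_∣ (map-id q)) (∣p⊠q∣≡∣p∣*∣q∣ p q) ⟩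
  ∣ q ∣ + ∣ p ∣ * ∣ q ∣     ∎
  where open ≡-Reasoning
∣p⊠q∣≡∣p∣*∣q∣ {k = k} (outside ∷ p) q = begin
  ∣ map (const outside) q ++ p ⊠ q ∣    ≡⟨ ∣p++q∣≡∣p∣+∣q∣ (map (const outside) q) (p ⊠ q) ⟩
  ∣ map (const outside) q ∣ + ∣ p ⊠ q ∣  ≡⟨ cong₂ _+_ ∣outside∣≡0 (∣p⊠q∣≡∣p∣*∣q∣ p q) ⟩
  ∣ p ∣ * ∣ q ∣                         ∎
  where
  open ≡-Reasoning
  ∣outside∣≡0 : ∣ map (const outside) q ∣ ≡ 0
  ∣outside∣≡0 = trans (cong ∣_∣ (map-const q outside)) (∣⊥∣≡0 k)

2≤m⇒∃≢ : ∀ {m} → 2 ≤ m → (x : Fin m) → ∃ λ y → x ≢ y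
2≤m⇒∃≢ {suc (suc m)} _ x = punchIn x zero , punchInᵢ≢i x zero ∘ sym
2≤m⇒∃≢ {suc zero} (s≤s ())

Dominating : (G : Graph) → Subset (n G) → Set
Dominating G D = ∀ x → x ∉ D → ∃ λ y → y ∈ D × Adj G x y

module Properties (G : Graph) where

  Adj-sym : ∀ {x y} → Adj G x y → Adj G y x
  Adj-sym {x} {y} a = trans (Graph.sym G y x) a

  Adj-irrefl : ∀ {x} → ¬ Adj G x x
  Adj-irrefl {x} a with trans (sym a) (irrefl G x)
  ... | ()

  module _ {A : Subset (n G)} where

    private
      lookup-N[] : ∀ x → lookup (N[_] {G} A) x
                         ≡ lookup A x ∨ any (λ y → lookup A y ∧ adj G x y) (allFin (n G))
      lookup-N[] = lookup∘tabulate _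

    ∈N[]-self : ∀ {x} → x ∈ A → x ∈ N[_] {G} A
    ∈N[]-self {x} x∈A = from ∈⇔T-lookup
      (subst T (sym (lookup-N[] x)) (from T-∨ (inj₁ (to ∈⇔T-lookup x∈A))))

    ∈N[]-adj : ∀ {x y} → y ∈ A → Adj G x y → x ∈ N[_] {G} A
    ∈N[]-adj {x} {y} y∈A xy = from ∈⇔T-lookup
      (subst T (sym (lookup-N[] x)) (from T-∨ (inj₂ (any⁺ _ (lose (∈-allFin y)
        (from T-∧ (to ∈⇔T-lookup y∈A , from T-≡ xy)))))))

    ∈N[]⁻ : ∀ {x} → x ∈ N[_] {G} A → x ∈ A ⊎ ∃ λ y → y ∈ A × Adj G x y
    ∈N[]⁻ {x} x∈N with to T-∨ (subst T (lookup-N[] x) (to ∈⇔T-lookup x∈N))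
    ... | inj₁ x∈A = inj₁ (from ∈⇔T-lookup x∈A)
    ... | inj₂ any-y with satisfied (any⁻ _ (allFin (n G)) any-y)
    ...   | y , t with to T-∧ t
    ...     | y∈A , xy = inj₂ (y , from ∈⇔T-lookup y∈A , to T-≡ xy)

  ∪⁅⁆-independent : ∀ {I x} → Independent G I → x ∉ N[_] {G} I → Independent G (I ∪ ⁅ x ⁆)
  ∪⁅⁆-independent {I} {x} indI x∉N a b a∈ b∈ with x∈p∪q⁻ I ⁅ x ⁆ a∈ | x∈p∪q⁻ I ⁅ x ⁆ b∈
  ... | inj₁ a∈I | inj₁ b∈I = indI a b a∈I b∈I
  ... | inj₁ a∈I | inj₂ b∈⁅x⁆ rewrite x∈⁅y⁆⇒x≡y x b∈⁅x⁆ = λ ax → x∉N (∈N[]-adj a∈I (Adj-sym ax))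
  ... | inj₂ a∈⁅x⁆ | inj₁ b∈I rewrite x∈⁅y⁆⇒x≡y x a∈⁅x⁆ = λ xb → x∉N (∈N[]-adj b∈I xb)
  ... | inj₂ a∈⁅x⁆ | inj₂ b∈⁅x⁆ rewrite x∈⁅y⁆⇒x≡y x a∈⁅x⁆ | x∈⁅y⁆⇒x≡y x b∈⁅x⁆ = Adj-irrefl

  ⊥-independent : Independent G ⊥
  ⊥-independent _ _ x∈⊥ = contradiction x∈⊥ ∉⊥

  N[⊥]≡⊥ : N[_] {G} ⊥ ≡ ⊥
  N[⊥]≡⊥ = Empty-unique λ (x , x∈N) → [ ∉⊥ , ∉⊥ ∘ proj₁ ∘ proj₂ ]′ (∈N[]⁻ {A = ⊥} x∈N)

  dominating-or-extensible : ∀ I → Dominating G I ⊎ ∃ λ x → x ∉ N[_] {G} I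
  dominating-or-extensible I with any? (λ x → ¬? (x ∈? N[_] {G} I))
  ... | yes extensible = inj₂ extensible
  ... | no ¬extensible = inj₁ dominating
    where
    dominating : Dominating G I
    dominating x x∉I with ∈N[]⁻ {A = I} (decidable-stable (x ∈? N[_] {G} I) (λ x∉N → ¬extensible (x , x∉N)))
    ... | inj₁ x∈I = contradiction x∈I x∉I
    ... | inj₂ y   = y

  independent-dominating-set : ∃ λ D → Independent G D × Dominating G D
  independent-dominating-set = grow (n G) ⊥ ⊥-independent (≤-reflexive (cong (_+ n G) (sym (∣⊥∣≡0 (n G)))))
    where
    grow : ∀ fuel I → Independent G I → n G ≤ ∣ I ∣ + fuel → ∃ λ D → Independent G D × Dominating G D
    grow fuel I indI bound with dominating-or-extensible I
    ... | inj₁ domI = I , indI , domI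
    ... | inj₂ (x , x∉N) with ∣p∪⁅x⁆∣≡1+∣p∣ {p = I} (x∉N ∘ ∈N[]-self)
    ...   | ∣I∪x∣≡1+∣I∣ with fuel
    ...     | zero = contradiction (subst (_≤ n G) ∣I∪x∣≡1+∣I∣ (∣p∣≤n (I ∪ ⁅ x ⁆)))
                                   (≤⇒≯ (subst (n G ≤_) (+-identityʳ ∣ I ∣) bound))
    ...     | suc fuel′ = grow fuel′ (I ∪ ⁅ x ⁆) (∪⁅⁆-independent indI x∉N)
                (subst (n G ≤_) (trans (+-suc ∣ I ∣ fuel′) (cong (_+ fuel′) (sym ∣I∪x∣≡1+∣I∣))) bound)

  maximum-independent⇒∁N[]≡⊥ : ∀ {I} → Independent G I → (∀ J → Independent G J → ∣ J ∣ ≤ ∣ I ∣) →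
                               ∁ (N[_] {G} I) ≡ ⊥
  maximum-independent⇒∁N[]≡⊥ {I} indI maximum = Empty-unique λ (x , x∈∁N) →
    <⇒≱ (subst (∣ I ∣ <_) (sym (∣p∪⁅x⁆∣≡1+∣p∣ {p = I} (x∈∁p⇒x∉p x∈∁N ∘ ∈N[]-self))) ≤-refl)
        (maximum (I ∪ ⁅ x ⁆) (∪⁅⁆-independent indI (x∈∁p⇒x∉p x∈∁N)))

  ∉N[]⇒∃-neighbour-∉N[] : NoIsolatable G → ∀ {A x} → Independent G A → x ∉ N[_] {G} A →
                         ∃ λ y → Adj G x y × y ∉ N[_] {G} A
  ∉N[]⇒∃-neighbour-∉N[] noIsolatable {A} {x} indA x∉N
    with ¬∀⟶∃¬ (n G) (λ y → Adj G x y → y ∈ N[_] {G} A)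
               (λ y → (adj G x y Bool.≟ true) →-dec (y ∈? N[_] {G} A))
               (λ N[x]⊆N[A] → noIsolatable x (A , indA , x∉N , N[x]⊆N[A]))
  ... | y , ¬xy⇒y∈N =
    y , decidable-stable (adj G x y Bool.≟ true) (λ ¬xy → ¬xy⇒y∈N (λ xy → contradiction xy ¬xy))
      , λ y∈N → ¬xy⇒y∈N (const y∈N)

  dominating⇒nonempty : ∀ {D} → Dominating G D → Fin (n G) → Nonempty D
  dominating⇒nonempty {D} domD x with x ∈? D
  ... | yes x∈D = x , x∈D
  ... | no  x∉D = let (y , y∈D , _) = domD x x∉D in y , y∈D

  connected⇒no-isolated-vertex : Nontrivial G → Connected G → ∀ x → ∃ λ y → Adj G x y
  connected⇒no-isolated-vertex nontrivial connected x with 2≤m⇒∃≢ nontrivial x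
  ... | y , x≢y = first-step x≢y (connected x y)
    where
    first-step : ∀ {y} → x ≢ y → Walk G x y → ∃ λ z → Adj G x z
    first-step x≢x here         = contradiction refl x≢x
    first-step _   (step xz _) = _ , xz

independent-dominating⇒maximal : ∀ {G I} → Independent G I → Dominating G I → MaximalIndependent G I
independent-dominating⇒maximal {G} {I} indI domI = indI , λ J indJ I⊆J → ⊆-antisym (J⊆I indJ I⊆J) I⊆J
  where
  J⊆I : ∀ {J} → Independent G J → I ⊆ J → J ⊆ I
  J⊆I indJ I⊆J {x} x∈J = decidable-stable (x ∈? I) λ x∉I →
    let (y , y∈I , xy) = domI x x∉I in indJ x y x∈J (I⊆J y∈I) xy

∀-combine : ∀ {m k} {P : Fin (m * k) → Set} → (∀ g h → P (combine g h)) → ∀ u → P u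
∀-combine {m} {k} {P} P-combine u = subst P (combine-remQuot {m} k u) (uncurry P-combine (remQuot {m} k u))

module _ {G H : Graph} {g g′ : Fin (n G)} {h h′ : Fin (n H)} where

  adj-×ᴳ : adj (G ×ᴳ H) (combine g h) (combine g′ h′) ≡ adj G g g′ ∧ adj H h h′
  adj-×ᴳ = cong₂ (λ (g₁ , h₁) (g₂ , h₂) → adj G g₁ g₂ ∧ adj H h₁ h₂)
                 (remQuot-combine {n G} {n H} g h) (remQuot-combine {n G} {n H} g′ h′)

  Adj-×ᴳ⁺ : Adj G g g′ → Adj H h h′ → Adj (G ×ᴳ H) (combine g h) (combine g′ h′)
  Adj-×ᴳ⁺ gg′ hh′ = trans adj-×ᴳ (cong₂ _∧_ gg′ hh′)

  Adj-×ᴳ⁻ : Adj (G ×ᴳ H) (combine g h) (combine g′ h′) → Adj G g g′ × Adj H h h′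
  Adj-×ᴳ⁻ a with to T-∧ (from T-≡ (trans (sym adj-×ᴳ) a))
  ... | gg′ , hh′ = to T-≡ gg′ , to T-≡ hh′

module Lift {G H : Graph} (noIsolatable : NoIsolatable G) (no-isolated : ∀ h → ∃ λ h′ → Adj H h h′)
            {B : Subset (n H)} (indB : Independent H B) (domB : Dominating H B) where

  open Properties G

  lift : Subset (n G) → Subset (n G * n H)
  lift A = A ⊠ ⊤ {n H} ∪ ∁ (N[_] {G} A) ⊠ B

  module _ {A : Subset (n G)} {g : Fin (n G)} {h : Fin (n H)} where

    ∈lift⁺ˡ : g ∈ A → combine g h ∈ lift A
    ∈lift⁺ˡ g∈A = x∈p∪q⁺ (inj₁ (x∈p⊠q⁺ g∈A ∈⊤))

    ∈lift⁺ʳ : g ∉ N[_] {G} A → h ∈ B → combine g h ∈ lift A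
    ∈lift⁺ʳ g∉N h∈B = x∈p∪q⁺ (inj₂ (x∈p⊠q⁺ (x∉p⇒x∈∁p g∉N) h∈B))

    ∈lift⁻ : combine g h ∈ lift A → g ∈ A ⊎ (g ∉ N[_] {G} A × h ∈ B)
    ∈lift⁻ gh∈ with x∈p∪q⁻ (A ⊠ ⊤ {n H}) (∁ (N[_] {G} A) ⊠ B) gh∈
    ... | inj₁ gh∈A⊠⊤ = inj₁ (proj₁ (x∈p⊠q⁻ gh∈A⊠⊤))
    ... | inj₂ gh∈∁N⊠B with x∈p⊠q⁻ gh∈∁N⊠B
    ...   | g∈∁N , h∈B = inj₂ (x∈∁p⇒x∉p g∈∁N , h∈B)

  ∣lift∣ : ∀ A → ∣ lift A ∣ ≡ ∣ A ∣ * n H + ∣ ∁ (N[_] {G} A) ∣ * ∣ B ∣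
  ∣lift∣ A = begin
    ∣ A ⊠ ⊤ ∪ ∁ N[A] ⊠ B ∣                    ≡⟨ ∣p∪q∣≡∣p∣+∣q∣ (A ⊠ ⊤) (∁ N[A] ⊠ B) disjoint ⟩
    ∣ A ⊠ ⊤ ∣ + ∣ ∁ N[A] ⊠ B ∣                ≡⟨ cong₂ _+_ (∣p⊠q∣≡∣p∣*∣q∣ A ⊤) (∣p⊠q∣≡∣p∣*∣q∣ (∁ N[A]) B) ⟩
    ∣ A ∣ * ∣ ⊤ {n H} ∣ + ∣ ∁ N[A] ∣ * ∣ B ∣  ≡⟨ cong (λ m → ∣ A ∣ * m + ∣ ∁ N[A] ∣ * ∣ B ∣) (∣⊤∣≡n (n H)) ⟩
    ∣ A ∣ * n H + ∣ ∁ N[A] ∣ * ∣ B ∣          ∎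
    where
    open ≡-Reasoning
    N[A] = N[_] {G} A
    disjoint : Empty (A ⊠ ⊤ {n H} ∩ ∁ N[A] ⊠ B)
    disjoint (u , u∈) = ∀-combine {n G} {P = λ u → ¬ u ∈ A ⊠ ⊤ {n H} ∩ ∁ N[A] ⊠ B} excluded u u∈
      where
      excluded : ∀ (g : Fin (n G)) (h : Fin (n H)) → ¬ combine g h ∈ A ⊠ ⊤ {n H} ∩ ∁ N[A] ⊠ B
      excluded g h gh∈ with x∈p∩q⁻ (A ⊠ ⊤ {n H}) (∁ N[A] ⊠ B) gh∈
      ... | gh∈A⊠⊤ , gh∈∁N⊠B = x∈p⇒x∉∁p (∈N[]-self g∈A) g∈∁N
        where
        g∈A  = proj₁ (x∈p⊠q⁻ {p = A} {q = ⊤ {n H}} gh∈A⊠⊤)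
        g∈∁N = proj₁ (x∈p⊠q⁻ {p = ∁ N[A]} gh∈∁N⊠B)

  lift-independent : ∀ {A} → Independent G A → Independent (G ×ᴳ H) (lift A)
  lift-independent {A} indA = ∀-combine {n G} λ g h → ∀-combine {n G} λ g′ h′ → separated
    where
    separated : ∀ {g g′ : Fin (n G)} {h h′ : Fin (n H)} → combine g h ∈ lift A → combine g′ h′ ∈ lift A →
                ¬ Adj (G ×ᴳ H) (combine g h) (combine g′ h′)
    separated gh∈ g′h′∈ a with Adj-×ᴳ⁻ {G = G} {H = H} a | ∈lift⁻ gh∈ | ∈lift⁻ g′h′∈
    ... | gg′ , _   | inj₁ g∈A         | inj₁ g′∈A          = indA _ _ g∈A g′∈A gg′
    ... | gg′ , _   | inj₁ g∈A         | inj₂ (g′∉N , _)    = g′∉N (∈N[]-adj g∈A (Adj-sym gg′))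
    ... | gg′ , _   | inj₂ (g∉N , _)   | inj₁ g′∈A          = g∉N (∈N[]-adj g′∈A gg′)
    ... | _   , hh′ | inj₂ (_ , h∈B)   | inj₂ (_ , h′∈B)    = indB _ _ h∈B h′∈B hh′

  lift-dominating : ∀ {A} → Independent G A → Dominating (G ×ᴳ H) (lift A)
  lift-dominating {A} indA = ∀-combine {n G} dominated
    where
    dominated : ∀ g h → combine g h ∉ lift A → ∃ λ v → v ∈ lift A × Adj (G ×ᴳ H) (combine g h) v
    dominated g h gh∉ with g ∈? N[_] {G} A
    ... | yes g∈N with ∈N[]⁻ g∈N
    ...   | inj₁ g∈A = contradiction (∈lift⁺ˡ {A = A} g∈A) gh∉
    ...   | inj₂ (y , y∈A , gy) with no-isolated h
    ...     | h′ , hh′ = combine y h′ , ∈lift⁺ˡ {A = A} y∈A , Adj-×ᴳ⁺ {G = G} {H = H} gy hh′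
    dominated g h gh∉ | no g∉N with h ∈? B
    ... | yes h∈B = contradiction (∈lift⁺ʳ {A = A} g∉N h∈B) gh∉
    ... | no h∉B with domB h h∉B | ∉N[]⇒∃-neighbour-∉N[] noIsolatable indA g∉N
    ...   | b , b∈B , hb | y , gy , y∉N =
      combine y b , ∈lift⁺ʳ {A = A} y∉N b∈B , Adj-×ᴳ⁺ {G = G} {H = H} gy hb

  lift-maximal : ∀ {A} → Independent G A → MaximalIndependent (G ×ᴳ H) (lift A)
  lift-maximal {A} indA =
    independent-dominating⇒maximal {G ×ᴳ H} {lift A} (lift-independent indA) (lift-dominating indA)

  ∣lift⊥∣ : ∣ lift ⊥ ∣ ≡ n G * ∣ B ∣
  ∣lift⊥∣ = begin
    ∣ lift ⊥ ∣                                      ≡⟨ ∣lift∣ ⊥ ⟩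
    ∣ ⊥ {n G} ∣ * n H + ∣ ∁ (N[_] {G} ⊥) ∣ * ∣ B ∣  ≡⟨ cong₂ (λ a c → a * n H + c * ∣ B ∣) (∣⊥∣≡0 (n G)) ∣∁N[⊥]∣≡n ⟩
    n G * ∣ B ∣                                     ∎
    where
    open ≡-Reasoning
    ∣∁N[⊥]∣≡n : ∣ ∁ (N[_] {G} ⊥) ∣ ≡ n G
    ∣∁N[⊥]∣≡n = begin
      ∣ ∁ (N[_] {G} ⊥) ∣   ≡⟨ cong (∣_∣ ∘ ∁) N[⊥]≡⊥ ⟩
      ∣ ∁ (⊥ {n G}) ∣      ≡⟨ ∣∁p∣≡n∸∣p∣ (⊥ {n G}) ⟩
      n G ∸ ∣ ⊥ {n G} ∣    ≡⟨ cong (n G ∸_) (∣⊥∣≡0 (n G)) ⟩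
      n G                  ∎

  well-covered⇒lift-count : WellCovered (G ×ᴳ H) → ∀ {A} → Independent G A →
                            ∣ A ∣ * n H + ∣ ∁ (N[_] {G} A) ∣ * ∣ B ∣ ≡ n G * ∣ B ∣
  well-covered⇒lift-count wellCovered {A} indA = begin
    ∣ A ∣ * n H + ∣ ∁ (N[_] {G} A) ∣ * ∣ B ∣  ≡⟨ ∣lift∣ A ⟨
    ∣ lift A ∣                               ≡⟨ wellCovered _ _ (lift-maximal indA) (lift-maximal ⊥-independent) ⟩
    ∣ lift ⊥ ∣                               ≡⟨ ∣lift⊥∣ ⟩
    n G * ∣ B ∣                              ∎
    where open ≡-Reasoning

cross-multiply : ∀ {nG nH β ν c k α} .{{_ : NonZero β}} →
                 α * nH ≡ nG * β → k * nH + c * β ≡ nG * β → ν + c ≡ nG → ν * α ≡ k * nG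
cross-multiply {nG} {nH} {β} {ν} {c} {k} {α} α∣H∣≡∣G∣β k∣H∣+cβ≡∣G∣β ν+c≡nG =
  *-cancelʳ-≡ (ν * α) (k * nG) β (begin
  ν * α * β    ≡⟨ *-assoc ν α β ⟩
  ν * (α * β)  ≡⟨ cong (ν *_) (*-comm α β) ⟩
  ν * (β * α)  ≡⟨ *-assoc ν β α ⟨
  ν * β * α    ≡⟨ cong (_* α) νβ≡k∣H∣ ⟩
  k * nH * α   ≡⟨ *-assoc k nH α ⟩
  k * (nH * α) ≡⟨ cong (k *_) (trans (*-comm nH α) α∣H∣≡∣G∣β) ⟩
  k * (nG * β) ≡⟨ *-assoc k nG β ⟨
  k * nG * β   ∎)
  where
  open ≡-Reasoning
  νβ≡k∣H∣ : ν * β ≡ k * nH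
  νβ≡k∣H∣ = +-cancelʳ-≡ (c * β) (ν * β) (k * nH) (begin
    ν * β + c * β  ≡⟨ *-distribʳ-+ β ν c ⟨
    (ν + c) * β    ≡⟨ cong (_* β) ν+c≡nG ⟩
    nG * β         ≡⟨ k∣H∣+cβ≡∣G∣β ⟨
    k * nH + c * β ∎)

lemma4p1 : (G H : Graph) → Nontrivial H → Connected H → NoIsolatable G
    → WellCovered (G ×ᴳ H)
    → (α k : ℕ) → IsIndependenceNumber G α → 1 ≤ k → k ≤ α
    → (A : Subset (n G)) → Independent G A → ∣ A ∣ ≡ k
    → ∣ N[_] {G} A ∣ * α ≡ k * order G
lemma4p1 G H nontrivial connected noIsolatable wellCovered α k ((I , indI , ∣I∣≡α) , α-max) _ _ A indA ∣A∣≡k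
  with Properties.independent-dominating-set H
... | B , indB , domB =
  cross-multiply {ν = ∣ N[_] {G} A ∣} {k = k} {{>-nonZero 0<∣B∣}}
    α∣H∣≡∣G∣∣B∣ k∣H∣+c∣B∣≡∣G∣∣B∣ (∣p∣+∣∁p∣≡n (N[_] {G} A))
  where
  open Properties
  open Lift {G} {H} noIsolatable (connected⇒no-isolated-vertex H nontrivial connected) indB domB

  0<∣B∣ : 0 < ∣ B ∣
  0<∣B∣ = x∈p⇒0<∣p∣ (proj₂ (dominating⇒nonempty H domB (fromℕ< nontrivial)))

  ∣∁N[I]∣≡0 : ∣ ∁ (N[_] {G} I) ∣ ≡ 0
  ∣∁N[I]∣≡0 = trans (cong ∣_∣ (maximum-independent⇒∁N[]≡⊥ G indI I-maximum)) (∣⊥∣≡0 (n G))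
    where
    I-maximum : ∀ J → Independent G J → ∣ J ∣ ≤ ∣ I ∣
    I-maximum J indJ = subst (∣ J ∣ ≤_) (sym ∣I∣≡α) (α-max J indJ)

  α∣H∣≡∣G∣∣B∣ : α * n H ≡ n G * ∣ B ∣
  α∣H∣≡∣G∣∣B∣ = begin
    α * n H                                   ≡⟨ +-identityʳ (α * n H) ⟨
    α * n H + 0 * ∣ B ∣                        ≡⟨ cong₂ (λ a c → a * n H + c * ∣ B ∣) (sym ∣I∣≡α) (sym ∣∁N[I]∣≡0) ⟩
    ∣ I ∣ * n H + ∣ ∁ (N[_] {G} I) ∣ * ∣ B ∣  ≡⟨ well-covered⇒lift-count wellCovered indI ⟩
    n G * ∣ B ∣                               ∎
    where open ≡-Reasoning

  k∣H∣+c∣B∣≡∣G∣∣B∣ : k * n H + ∣ ∁ (N[_] {G} A) ∣ * ∣ B ∣ ≡ n G * ∣ B ∣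
  k∣H∣+c∣B∣≡∣G∣∣B∣ = subst (λ a → a * n H + ∣ ∁ (N[_] {G} A) ∣ * ∣ B ∣ ≡ n G * ∣ B ∣) ∣A∣≡k
                       (well-covered⇒lift-count wellCovered indA)
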